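{- For all integers $n,k\ge1$, $r_o(K_{1,k},P_n)=k(n-1)$.
   Context: An ordered graph is a graph with a linear ordering on its vertices; subgraphs inherit the ordering, and copies are taken via order-preserving isomorphisms. The ordered path $P_n$ has vertices $v_1<\dots<v_n$ and edges $v_iv_{i+1}$. The ordered graph $K_{1,k}$ has vertices $u<w_1<\dots<w_k$ and edges $uw_1,\dots,uw_k$ (a vertex joined to $k$ vertices all to its right). The online ordered Ramsey game for ordered graphs $G,H$ is played on vertex set $\mathbb N$ with its usual order: on each turn Builder draws a new edge between two vertices and Painter colors it red or blue; the game ends when there is a red copy of $G$ or a blue copy of $H$. Builder minimizes and Painter maximizes the number of turns; $r_o(G,H)$ is the number of turns under optimal play. -}

module Defs where

open import Data.Nat using (ℕ; zero; suc; _<_; _≤_)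
open import Data.Fin using (Fin; toℕ)
open import Data.Product using (Σ; _×_; _,_)
open import Data.Sum using (_⊎_)
open import Data.List using (List; []; _∷_)
open import Data.List.Membership.Propositional using (_∈_)
open import Relation.Nullary using (¬_)
open import Relation.Binary.PropositionalEquality using (_≡_)

-- An ordered graph on vertex set Fin m (ordered as 0 < 1 < ... < m-1).
-- Adj i j is only consulted for i < j (edges are unordered pairs).
record OrderedGraph : Set₁ where
  field
    size : ℕ
    Adj  : Fin size → Fin size → Set
open OrderedGraph public

P : ℕ → OrderedGraph
P n = record { size = n ; Adj = λ i j → toℕ j ≡ suc (toℕ i) }

K1 : ℕ → OrderedGraph
K1 k = record { size = suc k ; Adj = λ i j → (toℕ i ≡ 0) × (0 < toℕ j) }

data Colour : Set where
  red blue : Colour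

-- A board state: the list of drawn edges (a , b , c) with a < b in ℕ, coloured c.
Board : Set
Board = List (ℕ × ℕ × Colour)

ColouredCopy : OrderedGraph → Colour → Board → Set
ColouredCopy G c s =
  Σ (Fin (size G) → ℕ) λ f →
    ((i j : Fin (size G)) → toℕ i < toℕ j → f i < f j) ×
    ((i j : Fin (size G)) → toℕ i < toℕ j → Adj G i j → (f i , f j , c) ∈ s)

Ended : OrderedGraph → OrderedGraph → Board → Set
Ended G H s = ColouredCopy G red s ⊎ ColouredCopy H blue s

-- Builder can force the game to end within t further turns from board s,
-- whatever Painter does. Each turn Builder draws a new edge ab (a < b).
BuilderWins : OrderedGraph → OrderedGraph → ℕ → Board → Set
BuilderWins G H zero    s = Ended G H s
BuilderWins G H (suc t) s =
  Ended G H s ⊎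
  Σ ℕ λ a → Σ ℕ λ b → (a < b) × (¬ (Σ Colour λ c → (a , b , c) ∈ s)) ×
    ((c : Colour) → BuilderWins G H t ((a , b , c) ∷ s))

OnlineOrderedRamsey : OrderedGraph → OrderedGraph → ℕ → Set
OnlineOrderedRamsey G H N =
  BuilderWins G H N [] × ((m : ℕ) → BuilderWins G H m [] → N ≤ m)

-- Builder keeps a blue path ending at a vertex x and a red fan centred at x, and always draws
-- the edge from x to a fresh vertex to the right of everything drawn so far.  A red answer
-- grows the fan, which becomes a red K_{1,k} after k of them, so Builder extends the blue path
-- by one edge every k moves at the latest: k(n-1) moves suffice.
-- Painter colours an edge red unless its left end already has k-1 red edges to its right.  Then
-- no red K_{1,k} appears, and the left end of every blue edge has at least k edges to its right.
-- The left ends of the n-1 edges of a blue P_n are distinct, so at that point the board holds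
-- at least k(n-1) edges.
module Submission where

open import Defs
open import Data.Nat using (ℕ; zero; suc; _+_; _*_; _∸_; _≤_; _<_; _≟_; _≤?_; z≤n; s≤s)
open import Data.Nat.Properties
open import Data.Fin using (Fin; zero; suc; toℕ; inject₁)
open import Data.Fin.Properties using (toℕ<n; toℕ-inject₁)
open import Data.Product using (Σ; _×_; _,_)
open import Data.Sum using (inj₁; inj₂)
open import Data.List using (List; []; _∷_; length; filter)
open import Data.List.Properties using (filter-accept; filter-reject; length-filter)
open import Data.List.Membership.Propositional using (_∈_)
open import Data.List.Membership.Propositional.Properties using (∈-filter⁺; ∈-length)
open import Data.List.Relation.Unary.Any using (here; there)
open import Data.List.Relation.Binary.Sublist.Propositional using (⊆-refl; _∷ʳ_)
open import Data.List.Relation.Binary.Sublist.Propositional.Properties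
  using (filter⁺; filter-⊆; length-mono-≤)
open import Data.Empty using (⊥-elim)
open import Function using (_∘_)
open import Relation.Nullary using (¬_; yes; no; contradiction)
open import Relation.Unary using (Decidable)
open import Relation.Binary.PropositionalEquality using (_≡_; refl; cong; sym; trans; subst; subst₂)

StrictlyIncreasing : ∀ {m} → (Fin m → ℕ) → Set
StrictlyIncreasing {m} g = (i j : Fin m) → toℕ i < toℕ j → g i < g j

IncreasingUpTo : ℕ → (ℕ → ℕ) → Set
IncreasingUpTo L p = ∀ i → i < L → p i < p (suc i)

increasingUpTo⇒< : ∀ {L p} → IncreasingUpTo L p → ∀ {i j} → i < j → j ≤ L → p i < p j
increasingUpTo⇒< p↑ {i} {suc j} (s≤s i≤j) j<L with m≤n⇒m<n∨m≡n i≤j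
... | inj₁ i<j  = <-trans (increasingUpTo⇒< p↑ i<j (<⇒≤ j<L)) (p↑ j j<L)
... | inj₂ refl = p↑ j j<L

increasingUpTo⇒strictlyIncreasing : ∀ {L p} → IncreasingUpTo L p →
                                    StrictlyIncreasing {suc L} (p ∘ toℕ)
increasingUpTo⇒strictlyIncreasing p↑ i j i<j = increasingUpTo⇒< p↑ i<j (≤-pred (toℕ<n j))

extendAfter : ℕ → (ℕ → ℕ) → ℕ → ℕ → ℕ
extendAfter L p y i with i ≤? L
... | yes _ = p i
... | no _  = y

extendAfter-≤ : ∀ {L p y i} → i ≤ L → extendAfter L p y i ≡ p i
extendAfter-≤ {L} {i = i} i≤L with i ≤? L
... | yes _  = refl
... | no i≰L = contradiction i≤L i≰L

extendAfter-> : ∀ {L p y i} → L < i → extendAfter L p y i ≡ y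
extendAfter-> {L} {i = i} L<i with i ≤? L
... | yes i≤L = contradiction i≤L (<⇒≱ L<i)
... | no _    = refl

increasingUpTo-extend : ∀ {L p y} → IncreasingUpTo L p → p L < y →
                        IncreasingUpTo (suc L) (extendAfter L p y)
increasingUpTo-extend {L} {p} {y} p↑ pL<y i (s≤s i≤L) with m≤n⇒m<n∨m≡n i≤L
... | inj₁ i<L  rewrite extendAfter-≤ {L} {p} {y} i≤L | extendAfter-≤ {L} {p} {y} i<L = p↑ i i<L
... | inj₂ refl rewrite extendAfter-≤ {L} {p} {y} i≤L | extendAfter-> {L} {p} {y} (n<1+n L) = pL<y

Edge : Set
Edge = ℕ × ℕ × Colour

leftEnd rightEnd : Edge → ℕ
leftEnd  (a , _ , _) = a
rightEnd (_ , b , _) = b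

Below : ℕ → Board → Set
Below N s = ∀ {a b c} → (a , b , c) ∈ s → b < N

record BluePath (s : Board) (L x : ℕ) : Set where
  field
    vertex     : ℕ → ℕ
    increasing : IncreasingUpTo L vertex
    ends-at    : vertex L ≡ x
    edge       : ∀ i → i < L → (vertex i , vertex (suc i) , blue) ∈ s

record RedFan (s : Board) (r x : ℕ) : Set where
  field
    leaf       : ℕ → ℕ
    increasing : IncreasingUpTo r leaf
    centred-at : leaf 0 ≡ x
    edge       : ∀ j → j < r → (x , leaf (suc j) , red) ∈ s

module _ {s : Board} where

  bluePath-trivial : ∀ x → BluePath s 0 x
  bluePath-trivial x = record { vertex = λ _ → x ; increasing = λ _ () ; ends-at = refl ; edge = λ _ () }

  bluePath-∷ : ∀ {L x} e → BluePath s L x → BluePath (e ∷ s) L x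
  bluePath-∷ e π = record { vertex = vertex ; increasing = increasing ; ends-at = ends-at
                           ; edge = λ i i<L → there (edge i i<L) }
    where open BluePath π

  bluePath-extend : ∀ {L x y} → BluePath s L x → x < y → BluePath ((x , y , blue) ∷ s) (suc L) y
  bluePath-extend {L} {x} {y} π x<y = record
    { vertex     = extendAfter L vertex y
    ; increasing = increasingUpTo-extend increasing (subst (_< y) (sym ends-at) x<y)
    ; ends-at    = extendAfter-> {L} {vertex} (n<1+n L)
    ; edge       = edge′
    }
    where
    open BluePath π
    edge′ : ∀ i → i < suc L →
            (extendAfter L vertex y i , extendAfter L vertex y (suc i) , blue) ∈ ((x , y , blue) ∷ s)
    edge′ i (s≤s i≤L) with m≤n⇒m<n∨m≡n i≤L
    ... | inj₁ i<L  rewrite extendAfter-≤ {L} {vertex} {y} i≤L | extendAfter-≤ {L} {vertex} {y} i<L =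
      there (edge i i<L)
    ... | inj₂ refl rewrite extendAfter-≤ {L} {vertex} {y} i≤L | extendAfter-> {L} {vertex} {y} (n<1+n L)
                          | ends-at = here refl

  bluePath⇒copy : ∀ {L x} → BluePath s L x → ColouredCopy (P (suc L)) blue s
  bluePath⇒copy {L} π = vertex ∘ toℕ , increasingUpTo⇒strictlyIncreasing increasing , edge′
    where
    open BluePath π
    edge′ : (i j : Fin (suc L)) → toℕ i < toℕ j → toℕ j ≡ suc (toℕ i) →
            (vertex (toℕ i) , vertex (toℕ j) , blue) ∈ s
    edge′ i j _ j≡1+i rewrite j≡1+i = edge (toℕ i) (subst (_≤ L) j≡1+i (≤-pred (toℕ<n j)))

  redFan-empty : ∀ x → RedFan s 0 x
  redFan-empty x = record { leaf = λ _ → x ; increasing = λ _ () ; centred-at = refl ; edge = λ _ () }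

  redFan-lastLeaf< : ∀ {r x N} (φ : RedFan s r x) → x < N → Below N s → RedFan.leaf φ r < N
  redFan-lastLeaf< {zero}  φ x<N _     = subst (_< _) (sym (RedFan.centred-at φ)) x<N
  redFan-lastLeaf< {suc j} φ _   below = below (RedFan.edge φ j (n<1+n j))

  redFan-extend : ∀ {r x y} (φ : RedFan s r x) → RedFan.leaf φ r < y →
                  RedFan ((x , y , red) ∷ s) (suc r) x
  redFan-extend {r} {x} {y} φ last<y = record
    { leaf       = extendAfter r leaf y
    ; increasing = increasingUpTo-extend increasing last<y
    ; centred-at = trans (extendAfter-≤ {r} {leaf} {y} z≤n) centred-at
    ; edge       = edge′
    }
    where
    open RedFan φ
    edge′ : ∀ j → j < suc r → (x , extendAfter r leaf y (suc j) , red) ∈ ((x , y , red) ∷ s)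
    edge′ j (s≤s j≤r) with m≤n⇒m<n∨m≡n j≤r
    ... | inj₁ j<r  rewrite extendAfter-≤ {r} {leaf} {y} j<r = there (edge j j<r)
    ... | inj₂ refl rewrite extendAfter-> {r} {leaf} {y} (n<1+n r) = here refl

  redFan⇒copy : ∀ {r x} → RedFan s r x → ColouredCopy (K1 r) red s
  redFan⇒copy {r} {x} φ = leaf ∘ toℕ , increasingUpTo⇒strictlyIncreasing increasing , edge′
    where
    open RedFan φ
    spoke : ∀ m → 0 < m → m ≤ r → (x , leaf m , red) ∈ s
    spoke (suc j) _ j<r = edge j j<r
    edge′ : (i j : Fin (suc r)) → toℕ i < toℕ j → (toℕ i ≡ 0) × (0 < toℕ j) →
            (leaf (toℕ i) , leaf (toℕ j) , red) ∈ s
    edge′ i j _ (i≡0 , 0<j) rewrite i≡0 | centred-at = spoke (toℕ j) 0<j (≤-pred (toℕ<n j))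

ended⇒builderWins : ∀ {G H s} t → Ended G H s → BuilderWins G H t s
ended⇒builderWins zero    ended = ended
ended⇒builderWins (suc t) ended = inj₁ ended

module BuilderStrategy (n k : ℕ) where

  record Position (s : Board) (d r : ℕ) : Set where
    field
      pathLength end fresh : ℕ
      pathLength+d≡n : pathLength + d ≡ n
      path           : BluePath s pathLength end
      fan            : RedFan s r end
      end<fresh      : end < fresh
      below          : Below fresh s

  start : Position [] n 0
  start = record
    { pathLength = 0 ; end = 0 ; fresh = 1 ; pathLength+d≡n = refl
    ; path = bluePath-trivial 0 ; fan = redFan-empty 0 ; end<fresh = s≤s z≤n ; below = λ () }

  module _ {s d r} (σ : Position s d r) where
    open Position σ

    move : Colour → Board
    move c = (end , fresh , c) ∷ s

    move-new : ¬ (Σ Colour λ c → (end , fresh , c) ∈ s)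
    move-new (_ , e∈s) = n≮n fresh (below e∈s)

    below-move : ∀ c → Below (suc fresh) (move c)
    below-move c (here refl)  = n<1+n fresh
    below-move c (there e∈s) = m<n⇒m<1+n (below e∈s)

    afterRed : Position (move red) d (suc r)
    afterRed = record
      { pathLength = pathLength ; end = end ; fresh = suc fresh
      ; pathLength+d≡n = pathLength+d≡n
      ; path = bluePath-∷ _ path
      ; fan = redFan-extend fan (redFan-lastLeaf< fan end<fresh below)
      ; end<fresh = m<n⇒m<1+n end<fresh
      ; below = below-move red
      }

  afterBlue : ∀ {s d r} (σ : Position s (suc d) r) → Position (move σ blue) d 0
  afterBlue {d = d} σ = record
    { pathLength = suc pathLength ; end = fresh ; fresh = suc fresh
    ; pathLength+d≡n = trans (sym (+-suc pathLength d)) pathLength+d≡n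
    ; path = bluePath-extend path end<fresh
    ; fan = redFan-empty fresh
    ; end<fresh = n<1+n fresh
    ; below = below-move σ blue
    }
    where open Position σ

  budget-exhausted : ∀ {r d} → r < k → ¬ k * suc d ≤ r + 0
  budget-exhausted {r} {d} r<k budget = <⇒≱ r<k (begin
    k          ≤⟨ m≤m+n k (k * d) ⟩
    k + k * d  ≡⟨ *-suc k d ⟨
    k * suc d  ≤⟨ budget ⟩
    r + 0      ≡⟨ +-identityʳ r ⟩
    r          ∎)
    where open ≤-Reasoning

  budget-blue : ∀ {r d t} → r < k → k * suc d ≤ r + suc t → k * d ≤ t
  budget-blue {r} {d} {t} r<k budget = +-cancelˡ-≤ k _ _ (begin
    k + k * d  ≡⟨ *-suc k d ⟨
    k * suc d  ≤⟨ budget ⟩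
    r + suc t  ≡⟨ +-suc r t ⟩
    suc r + t  ≤⟨ +-monoˡ-≤ t r<k ⟩
    k + t      ∎)
    where open ≤-Reasoning

  -- Each missing path edge costs at most k moves, of which the r red fan edges are already paid.
  builderWins : ∀ t {s d r} → r ≤ k → k * d ≤ r + t → Position s d r →
                BuilderWins (K1 k) (P (suc n)) t s
  builderWins t {d = zero} _ _ σ = ended⇒builderWins t (inj₂ (bluePath⇒copy fullPath))
    where
    open Position σ
    fullPath : BluePath _ n end
    fullPath = subst (λ L → BluePath _ L end) (trans (sym (+-identityʳ pathLength)) pathLength+d≡n) path
  builderWins t {d = suc d} {r} r≤k budget σ with r ≟ k
  ... | yes refl = ended⇒builderWins t (inj₁ (redFan⇒copy (Position.fan σ)))
  builderWins zero {d = suc d} {r} r≤k budget σ | no r≢k =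
    contradiction budget (budget-exhausted (≤∧≢⇒< r≤k r≢k))
  builderWins (suc t) {d = suc d} {r} r≤k budget σ | no r≢k =
    inj₂ (end , fresh , end<fresh , move-new σ , λ
      { red  → builderWins t r<k (subst (k * suc d ≤_) (+-suc r t) budget) (afterRed σ)
      ; blue → builderWins t z≤n (budget-blue r<k budget) (afterBlue σ) })
    where
    open Position σ
    r<k : r < k
    r<k = ≤∧≢⇒< r≤k r≢k

module _ {A : Set} (key : A → ℕ) where

  withKey : ℕ → List A → List A
  withKey t = filter (λ x → key x ≟ t)

  keyFrom : ℕ → List A → List A
  keyFrom t = filter (λ x → t ≤? key x)

  length-keyFrom-suc : ∀ t xs →
    length (withKey t xs) + length (keyFrom (suc t) xs) ≡ length (keyFrom t xs)
  length-keyFrom-suc t [] = refl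
  length-keyFrom-suc t (x ∷ xs) with key x ≟ t | t ≤? key x
  ... | yes refl | _
    rewrite filter-accept (λ y → key y ≟ t) {xs = xs} refl
          | filter-reject (λ y → suc t ≤? key y) {xs = xs} (n≮n t)
          | filter-accept (λ y → t ≤? key y) {xs = xs} (≤-refl {t})
    = cong suc (length-keyFrom-suc t xs)
  ... | no kx≢t | yes t≤kx
    rewrite filter-reject (λ y → key y ≟ t) {xs = xs} kx≢t
          | filter-accept (λ y → suc t ≤? key y) {xs = xs} (≤∧≢⇒< t≤kx (kx≢t ∘ sym))
          | filter-accept (λ y → t ≤? key y) {xs = xs} t≤kx
    = trans (+-suc _ _) (cong suc (length-keyFrom-suc t xs))
  ... | no kx≢t | no t≰kx
    rewrite filter-reject (λ y → key y ≟ t) {xs = xs} kx≢t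
          | filter-reject (λ y → suc t ≤? key y) {xs = xs} (t≰kx ∘ <⇒≤)
          | filter-reject (λ y → t ≤? key y) {xs = xs} t≰kx
    = length-keyFrom-suc t xs

  keyFrom-antitone : ∀ {t t′} → t ≤ t′ → ∀ xs → length (keyFrom t′ xs) ≤ length (keyFrom t xs)
  keyFrom-antitone t≤t′ xs = length-mono-≤
    (filter⁺ (λ y → _ ≤? key y) (λ y → _ ≤? key y) (λ { refl → ≤-trans t≤t′ }) (⊆-refl {x = xs}))

  module _ (xs : List A) where

    distinctKeys⇒*≤keyFrom : ∀ {m c} (g : Fin m → ℕ) → StrictlyIncreasing g →
      (∀ i → c ≤ length (withKey (g i) xs)) →
      ∀ t → (∀ i → t ≤ g i) → m * c ≤ length (keyFrom t xs)
    distinctKeys⇒*≤keyFrom {zero} _ _ _ _ _ = z≤n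
    distinctKeys⇒*≤keyFrom {suc m} {c} g g↑ enough t t≤g = begin
      c + m * c
        ≤⟨ +-mono-≤ (enough zero) rest ⟩
      length (withKey (g zero) xs) + length (keyFrom (suc (g zero)) xs)
        ≡⟨ length-keyFrom-suc (g zero) xs ⟩
      length (keyFrom (g zero) xs)
        ≤⟨ keyFrom-antitone (t≤g zero) xs ⟩
      length (keyFrom t xs) ∎
      where
      open ≤-Reasoning
      rest : m * c ≤ length (keyFrom (suc (g zero)) xs)
      rest = distinctKeys⇒*≤keyFrom (g ∘ suc) (λ i j i<j → g↑ (suc i) (suc j) (s≤s i<j))
               (enough ∘ suc) (suc (g zero)) (λ i → g↑ zero (suc i) (s≤s z≤n))

    distinctKeys⇒*≤length : ∀ {m c} (g : Fin m → ℕ) → StrictlyIncreasing g →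
      (∀ i → c ≤ length (withKey (g i) xs)) → m * c ≤ length xs
    distinctKeys⇒*≤length g g↑ enough =
      ≤-trans (distinctKeys⇒*≤keyFrom g g↑ enough 0 (λ _ → z≤n)) (length-filter _ xs)

length-filter-∷ : ∀ {A : Set} {P : A → Set} (P? : Decidable P) x xs →
                  length (filter P? xs) ≤ length (filter P? (x ∷ xs))
length-filter-∷ P? x xs = length-mono-≤ (filter⁺ P? P? (λ { refl p → p }) (x ∷ʳ ⊆-refl))

IsRed : Edge → Set
IsRed (_ , _ , c) = c ≡ red

isRed? : Decidable IsRed
isRed? (_ , _ , red)  = yes refl
isRed? (_ , _ , blue) = no λ ()

outEdges : ℕ → Board → Board
outEdges = withKey leftEnd

redOutEdges : ℕ → Board → Board
redOutEdges u s = outEdges u (filter isRed? s)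

redOutEdges≤outEdges : ∀ u s → length (redOutEdges u s) ≤ length (outEdges u s)
redOutEdges≤outEdges u s = length-mono-≤ (filter⁺ _ _ (λ { refl p → p }) (filter-⊆ isRed? s))

module PainterStrategy (k′ : ℕ) where

  Invariant : Board → Set
  Invariant s = (∀ u → length (redOutEdges u s) ≤ k′) ×
                (∀ {u v} → (u , v , blue) ∈ s → suc k′ ≤ length (outEdges u s))

  invariant-[] : Invariant []
  invariant-[] = (λ _ → z≤n) , λ ()

  colour : Board → ℕ → Colour
  colour s a with suc (length (redOutEdges a s)) ≤? k′
  ... | yes _ = red
  ... | no _  = blue

  invariant-∷ : ∀ {s} → Invariant s → ∀ a b → Invariant ((a , b , colour s a) ∷ s)
  invariant-∷ {s} (fewRed , manyOut) a b with suc (length (redOutEdges a s)) ≤? k′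
  ... | yes room =
    fewRed′ , λ { (there e∈s) → ≤-trans (manyOut e∈s) (length-filter-∷ _ (a , b , red) s) }
    where
    fewRed′ : ∀ u → length (redOutEdges u ((a , b , red) ∷ s)) ≤ k′
    fewRed′ u with a ≟ u
    ... | yes refl rewrite filter-accept (λ e → leftEnd e ≟ a) {a , b , red} {filter isRed? s} refl = room
    ... | no a≢u   rewrite filter-reject (λ e → leftEnd e ≟ u) {a , b , red} {filter isRed? s} a≢u = fewRed u
  ... | no full = fewRed , manyOut′
    where
    manyOut′ : ∀ {u v} → (u , v , blue) ∈ ((a , b , blue) ∷ s) →
               suc k′ ≤ length (outEdges u ((a , b , blue) ∷ s))
    manyOut′ (here refl) rewrite filter-accept (λ e → leftEnd e ≟ a) {a , b , blue} {s} refl =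
      s≤s (≤-trans (≮⇒≥ full) (redOutEdges≤outEdges a s))
    manyOut′ (there e∈s) = ≤-trans (manyOut e∈s) (length-filter-∷ _ (a , b , blue) s)

  noRedStar : ∀ {s} → Invariant s → ¬ ColouredCopy (K1 (suc k′)) red s
  noRedStar {s} (fewRed , _) (f , f↑ , edge) = n≮n k′ (begin-strict
    k′                             <⟨ n<1+n k′ ⟩
    suc k′                         ≡⟨ *-identityʳ (suc k′) ⟨
    suc k′ * 1                     ≤⟨ distinctKeys⇒*≤length rightEnd (redOutEdges centre s) leaf leaf↑ spoke ⟩
    length (redOutEdges centre s)  ≤⟨ fewRed centre ⟩
    k′                             ∎)
    where
    open ≤-Reasoning
    centre : ℕ
    centre = f zero
    leaf : Fin (suc k′) → ℕ
    leaf i = f (suc i)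
    leaf↑ : StrictlyIncreasing leaf
    leaf↑ i j i<j = f↑ (suc i) (suc j) (s≤s i<j)
    spoke : ∀ i → 1 ≤ length (withKey rightEnd (leaf i) (redOutEdges centre s))
    spoke i = ∈-length (∈-filter⁺ _ (∈-filter⁺ _ (∈-filter⁺ isRed? edge-i refl) refl) refl)
      where edge-i = edge zero (suc i) (s≤s z≤n) (refl , s≤s z≤n)

  bluePath⇒length : ∀ {n s} → Invariant s → ColouredCopy (P (suc n)) blue s → n * suc k′ ≤ length s
  bluePath⇒length {n} {s} (_ , manyOut) (f , f↑ , edge) =
    distinctKeys⇒*≤length leftEnd s tail tail↑ (λ i → manyOut (edge (inject₁ i) (suc i) (step i) (step≡ i)))
    where
    tail : Fin n → ℕ
    tail i = f (inject₁ i)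
    tail↑ : StrictlyIncreasing tail
    tail↑ i j i<j = f↑ (inject₁ i) (inject₁ j) (subst₂ _<_ (sym (toℕ-inject₁ i)) (sym (toℕ-inject₁ j)) i<j)
    step≡ : ∀ i → toℕ (suc i) ≡ suc (toℕ (inject₁ i))
    step≡ i = cong suc (sym (toℕ-inject₁ i))
    step : ∀ i → toℕ (inject₁ i) < toℕ (suc i)
    step i = ≤-reflexive (sym (step≡ i))

  ended⇒length : ∀ {n s} → Invariant s → Ended (K1 (suc k′)) (P (suc n)) s → n * suc k′ ≤ length s
  ended⇒length inv (inj₁ star) = ⊥-elim (noRedStar inv star)
  ended⇒length inv (inj₂ path) = bluePath⇒length inv path

  painterDelays : ∀ {n} m s → Invariant s → BuilderWins (K1 (suc k′)) (P (suc n)) m s →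
                  n * suc k′ ≤ length s + m
  painterDelays zero s inv ended = ≤-trans (ended⇒length inv ended) (m≤m+n (length s) 0)
  painterDelays (suc m) s inv (inj₁ ended) = ≤-trans (ended⇒length inv ended) (m≤m+n (length s) (suc m))
  painterDelays {n} (suc m) s inv (inj₂ (a , b , _ , _ , continue)) = begin
    n * suc k′          ≤⟨ painterDelays m _ (invariant-∷ inv a b) (continue (colour s a)) ⟩
    suc (length s + m)  ≡⟨ +-suc (length s) m ⟨
    length s + suc m    ∎
    where open ≤-Reasoning

lemma4p4 : (n k : ℕ) → 1 ≤ n → 1 ≤ k → OnlineOrderedRamsey (K1 k) (P n) (k * (n ∸ 1))
lemma4p4 (suc n) (suc k′) _ _ = builderWins (suc k′ * n) z≤n ≤-refl start , painterNeeds
  where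
  open BuilderStrategy n (suc k′)
  open PainterStrategy k′
  painterNeeds : (m : ℕ) → BuilderWins (K1 (suc k′)) (P (suc n)) m [] → suc k′ * n ≤ m
  painterNeeds m wins = subst (_≤ m) (*-comm n (suc k′)) (painterDelays m [] invariant-[] wins)
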